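{- For every Boolean function $f:\{0,1\}^n\times\{0,1\}^n\to\{0,1\}$ and every $k\ge1$, $GH_k(f)=\Omega(2^{D_k(f)/k})$.
   Context: Garden-hose model: Alice holds $x$, Bob holds $y$. A garden-hose protocol of size $s$ consists of a set $V$ of $s$ vertices (pipes) and an extra vertex $t$ (the tap), together with an assignment of a matching $E_A(x)$ on $V\cup\{t\}$ to every input $x$ of Alice and a matching $E_B(y)$ on $V$ to every input $y$ of Bob. In the graph $(V\cup\{t\},E_A(x)\cup E_B(y))$ every vertex has degree at most 2, so there is a unique maximal path starting at $t$ (the path of the water); the output on $(x,y)$ is the parity of the number of edges of this path. The protocol computes $f$ if the output equals $f(x,y)$ for all $(x,y)$. The wet pipes on input $(x,y)$ are the pipes on this path; $T_P$ is the maximum number of wet pipes over all inputs. $GH_k(f)$ is the minimum size of a garden-hose protocol $P$ computing $f$ with $T_P\le k$. $D_k(f)$ is the deterministic communication complexity of $f$ with protocols exchanging at most $k$ messages, Alice sending first. -}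

module Defs where

open import Data.Nat using (ℕ; zero; suc; _≤_; _⊔_)
open import Data.Bool using (Bool; true; false; not)
open import Data.Fin using (Fin; zero; suc)
open import Data.Maybe using (Maybe; just; nothing)
open import Data.Product using (Σ; _×_)
open import Data.Unit using (⊤)
open import Data.Empty using (⊥)
open import Data.Vec using (Vec)
open import Relation.Binary.PropositionalEquality using (_≡_; _≢_)

-- Matchings: a partial involution without fixed points.
-- M u ≡ just v  means  {u,v} is an edge of the matching.

IsMatching : {m : ℕ} → (Fin m → Maybe (Fin m)) → Set
IsMatching {m} M = ∀ (u v : Fin m) → M u ≡ just v → (M v ≡ just u) × (u ≢ v)

-- Garden-hose protocols of size s.
-- Vertex set V ∪ {t} is  Fin (suc s) : the tap t is  zero , pipe i is  suc i .
-- Alice's matching lives on V ∪ {t}, Bob's on V = Fin s.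

record GHProtocol (X Y : Set) (s : ℕ) : Set where
  field
    EA  : X → Fin (suc s) → Maybe (Fin (suc s))
    EAm : ∀ x → IsMatching (EA x)
    EB  : Y → Fin s → Maybe (Fin s)
    EBm : ∀ y → IsMatching (EB y)

open GHProtocol public

data Side : Set where
  sideA sideB : Side

-- Since every vertex has at most one Alice-edge and one Bob-edge, and the tap
-- only an Alice-edge, the maximal path from t alternates A,B,A,B,...; it has at
-- most s edges, so the fuel (suc s) always suffices.
module _ {X Y : Set} {s : ℕ} (P : GHProtocol X Y s) (x : X) (y : Y) where
  walk : ℕ → Side → Fin (suc s) → ℕ
  walk zero    _     _       = 0
  walk (suc n) sideA v with EA P x v
  ... | nothing = 0
  ... | just w  = suc (walk n sideB w)
  walk (suc n) sideB zero    = 0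
  walk (suc n) sideB (suc i) with EB P y i
  ... | nothing = 0
  ... | just j  = suc (walk n sideA (suc j))

  -- number of edges of the water path = number of wet pipes
  pathEdges : ℕ
  pathEdges = walk (suc s) sideA zero

parity : ℕ → Bool
parity zero    = false
parity (suc n) = not (parity n)

GHComputes : {X Y : Set} {s : ℕ} → GHProtocol X Y s → (X → Y → Bool) → Set
GHComputes {X} {Y} P f = ∀ (x : X) (y : Y) → parity (pathEdges P x y) ≡ f x y

WetBound : {X Y : Set} {s : ℕ} → GHProtocol X Y s → ℕ → Set
WetBound {X} {Y} P k = ∀ (x : X) (y : Y) → pathEdges P x y ≤ k

HasGH : {X Y : Set} → (X → Y → Bool) → ℕ → ℕ → Set
HasGH {X} {Y} f k s = Σ (GHProtocol X Y s) λ P → GHComputes P f × WetBound P k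

IsGH : {X Y : Set} → (X → Y → Bool) → ℕ → ℕ → Set
IsGH f k s = HasGH f k s × (∀ s' → HasGH f k s' → s ≤ s')

data Proto (X Y : Set) : Set where
  leaf  : Bool → Proto X Y
  bitA  : (X → Bool) → Proto X Y → Proto X Y → Proto X Y
  bitB  : (Y → Bool) → Proto X Y → Proto X Y → Proto X Y

run : {X Y : Set} → Proto X Y → X → Y → Bool
run (leaf b)     x y = b
run (bitA g l r) x y with g x
... | false = run l x y
... | true  = run r x y
run (bitB g l r) x y with g y
... | false = run l x y
... | true  = run r x y

depth : {X Y : Set} → Proto X Y → ℕ
depth (leaf b)     = 0
depth (bitA g l r) = suc (depth l ⊔ depth r)
depth (bitB g l r) = suc (depth l ⊔ depth r)

data Player : Set where
  alice bob : Player

-- MsgOK p m π : along every path, the current message is being sent by p,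
-- and at most m further messages (maximal blocks of bits by one player) follow.
MsgOK : {X Y : Set} → Player → ℕ → Proto X Y → Set
MsgOK p       m       (leaf b)     = ⊤
MsgOK alice   m       (bitA g l r) = MsgOK alice m l × MsgOK alice m r
MsgOK bob     zero    (bitA g l r) = ⊥
MsgOK bob     (suc m) (bitA g l r) = MsgOK alice m l × MsgOK alice m r
MsgOK bob     m       (bitB g l r) = MsgOK bob m l × MsgOK bob m r
MsgOK alice   zero    (bitB g l r) = ⊥
MsgOK alice   (suc m) (bitB g l r) = MsgOK bob m l × MsgOK bob m r

-- at most k messages, Alice sending first (k ≥ 1)
KMsg : {X Y : Set} → ℕ → Proto X Y → Set
KMsg k π = MsgOK alice (Data.Nat._∸_ k 1) π

HasD : {X Y : Set} → (X → Y → Bool) → ℕ → ℕ → Set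
HasD {X} {Y} f k d =
  Σ (Proto X Y) λ π → KMsg k π × (∀ (x : X) (y : Y) → run π x y ≡ f x y) × depth π ≤ d

IsD : {X Y : Set} → (X → Y → Bool) → ℕ → ℕ → Set
IsD f k d = HasD f k d × (∀ d' → HasD f k d' → d ≤ d')

BoolFun : ℕ → Set
BoolFun n = Vec Bool n → Vec Bool n → Bool

-- A garden-hose protocol is simulated by letting the player who owns the current edge of the
-- water path announce, in B bits, where the water goes next (2 ^ B > s + 1 covers the s + 1
-- vertices and "the path ends here").  The path has at most min k (s + 1) edges, so this takes at
-- most k messages and k * B bits, and the parity of the number of announcements is f x y.  Hence
-- D_k(f) ≤ k B; choosing 2 ^ B ≤ 2 (s + 1) gives 2 ^ D_k(f) ≤ (2 (s + 1)) ^ k.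
module Submission where

open import Defs
open import Data.Nat using (ℕ; suc; _*_; _^_; _≤_)
open import Data.Product using (∃-syntax)
open import Data.Nat using (zero; _+_; _∸_; _<_; _⊓_; z≤n; z<s; s≤s; s≤s⁻¹; _<?_; NonZero)
open import Data.Nat.Properties
open import Data.Bool using (Bool; true; false)
open import Data.Fin using (Fin; toℕ; fromℕ<; combine; remQuot)
open import Data.Fin.Patterns using (0F)
open import Data.Fin.Properties using (toℕ<n; toℕ-fromℕ<; fromℕ<-toℕ; combine-remQuot; 2↔Bool)
open import Data.Maybe using (Maybe; just; nothing; maybe′)
import Data.Maybe as Maybe
open import Data.Product using (_×_; _,_; proj₁; proj₂)
open import Data.Unit using (tt)
open import Data.Vec using (Vec; []; _∷_; head; tail)
open import Function using (_∘_; Inverse)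
open import Relation.Nullary using (yes; no; contradiction)
open import Relation.Binary.PropositionalEquality

module Binary where
  open Inverse 2↔Bool using (to; from; strictlyInverseʳ)

  bits : ∀ B → Fin (2 ^ B) → Vec Bool B
  bits zero    i = []
  bits (suc B) i = to (proj₁ (remQuot {2} (2 ^ B) i)) ∷ bits B (proj₂ (remQuot {2} (2 ^ B) i))

  fromBits : ∀ {B} → Vec Bool B → Fin (2 ^ B)
  fromBits []              = 0F
  fromBits {suc B} (b ∷ v) = combine {2} {2 ^ B} (from b) (fromBits v)

  fromBits-bits : ∀ B (i : Fin (2 ^ B)) → fromBits (bits B i) ≡ i
  fromBits-bits zero    0F = refl
  fromBits-bits (suc B) i =
    trans (cong₂ (combine {2} {2 ^ B}) (strictlyInverseʳ (proj₁ q)) (fromBits-bits B (proj₂ q)))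
          (combine-remQuot {2} (2 ^ B) i)
    where q = remQuot {2} (2 ^ B) i

  index : ∀ {m} → Maybe (Fin m) → ℕ
  index nothing  = 0
  index (just i) = suc (toℕ i)

  index< : ∀ {m} (o : Maybe (Fin m)) → index o < suc m
  index< nothing  = s≤s z≤n
  index< (just i) = s≤s (toℕ<n i)

  fromIndex : ∀ m → ℕ → Maybe (Fin m)
  fromIndex m zero    = nothing
  fromIndex m (suc j) with j <? m
  ... | yes j<m = just (fromℕ< j<m)
  ... | no  _   = nothing

  fromIndex-index : ∀ {m} (o : Maybe (Fin m)) → fromIndex m (index o) ≡ o
  fromIndex-index     nothing  = refl
  fromIndex-index {m} (just i) with toℕ i <? m
  ... | yes i<m = cong just (fromℕ<-toℕ i i<m)
  ... | no  i≮m = contradiction (toℕ<n i) i≮m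

  module Code {m B : ℕ} (m<2^B : m < 2 ^ B) where
    encode : Maybe (Fin m) → Vec Bool B
    encode o = bits B (fromℕ< (≤-trans (index< o) m<2^B))

    decode : Vec Bool B → Maybe (Fin m)
    decode v = fromIndex m (toℕ (fromBits v))

    decode-encode : ∀ o → decode (encode o) ≡ o
    decode-encode o = begin
      fromIndex m (toℕ (fromBits (bits B (fromℕ< index<2^B)))) ≡⟨ cong (fromIndex m ∘ toℕ) (fromBits-bits B _) ⟩
      fromIndex m (toℕ (fromℕ< index<2^B))                     ≡⟨ cong (fromIndex m) (toℕ-fromℕ< index<2^B) ⟩
      fromIndex m (index o)                                    ≡⟨ fromIndex-index o ⟩
      o                                                        ∎
      where
      open ≡-Reasoning
      index<2^B = ≤-trans (index< o) m<2^B

module Messages (X Y : Set) where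
  Input : Player → Set
  Input alice = X
  Input bob   = Y

  input : ∀ p → X → Y → Input p
  input alice x y = x
  input bob   x y = y

  ask : ∀ p → (Input p → Bool) → (Bool → Proto X Y) → Proto X Y
  ask alice g t = bitA g (t false) (t true)
  ask bob   g t = bitB g (t false) (t true)

  run-ask : ∀ p g t x y → run (ask p g t) x y ≡ run (t (g (input p x y))) x y
  run-ask alice g t x y with g x
  ... | false = refl
  ... | true  = refl
  run-ask bob   g t x y with g y
  ... | false = refl
  ... | true  = refl

  depth-ask : ∀ p g t {D} → (∀ b → depth (t b) ≤ D) → depth (ask p g t) ≤ suc D
  depth-ask alice g t h = s≤s (⊔-lub (h false) (h true))
  depth-ask bob   g t h = s≤s (⊔-lub (h false) (h true))

  MsgOK-ask : ∀ p {m} g t → (∀ b → MsgOK p m (t b)) → MsgOK p m (ask p g t)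
  MsgOK-ask alice g t h = h false , h true
  MsgOK-ask bob   g t h = h false , h true

  send : ∀ p B → (Input p → Vec Bool B) → (Vec Bool B → Proto X Y) → Proto X Y
  send p zero    msg k = k []
  send p (suc B) msg k = ask p (head ∘ msg) λ b → send p B (tail ∘ msg) (k ∘ (b ∷_))

  run-send : ∀ p B msg k x y → run (send p B msg k) x y ≡ run (k (msg (input p x y))) x y
  run-send p zero    msg k x y with msg (input p x y)
  ... | [] = refl
  run-send p (suc B) msg k x y =
    trans (run-ask p (head ∘ msg) _ x y)
          (trans (run-send p B (tail ∘ msg) _ x y) (cong (λ v → run (k v) x y) (head∷tail (msg (input p x y)))))
    where
    head∷tail : (v : Vec Bool (suc B)) → head v ∷ tail v ≡ v
    head∷tail (b ∷ v) = refl

  depth-send : ∀ p B msg k {D} → (∀ v → depth (k v) ≤ D) → depth (send p B msg k) ≤ B + D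
  depth-send p zero    msg k h = h []
  depth-send p (suc B) msg k h =
    depth-ask p (head ∘ msg) _ λ b → depth-send p B (tail ∘ msg) _ λ v → h (b ∷ v)

  MsgOK-send : ∀ p {m} B msg k → (∀ v → MsgOK p m (k v)) → MsgOK p m (send p B msg k)
  MsgOK-send p zero    msg k h = h []
  MsgOK-send p (suc B) msg k h =
    MsgOK-ask p (head ∘ msg) _ λ b → MsgOK-send p B (tail ∘ msg) _ λ v → h (b ∷ v)

  MsgOK-mono : ∀ p m (π : Proto X Y) → MsgOK p m π → MsgOK p (suc m) π
  MsgOK-mono p     m       (leaf b)     _         = tt
  MsgOK-mono alice m       (bitA g l r) (hl , hr) = MsgOK-mono alice m l hl , MsgOK-mono alice m r hr
  MsgOK-mono bob   (suc m) (bitA g l r) (hl , hr) = MsgOK-mono alice m l hl , MsgOK-mono alice m r hr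
  MsgOK-mono bob   m       (bitB g l r) (hl , hr) = MsgOK-mono bob m l hl , MsgOK-mono bob m r hr
  MsgOK-mono alice (suc m) (bitB g l r) (hl , hr) = MsgOK-mono bob m l hl , MsgOK-mono bob m r hr

  MsgOK-suc : ∀ p q m (π : Proto X Y) → MsgOK q m π → MsgOK p (suc m) π
  MsgOK-suc alice alice m       π            h         = MsgOK-mono alice m π h
  MsgOK-suc bob   bob   m       π            h         = MsgOK-mono bob m π h
  MsgOK-suc p     q     m       (leaf b)     _         = tt
  MsgOK-suc alice bob   m       (bitB g l r) h         = h
  MsgOK-suc bob   alice m       (bitA g l r) h         = h
  MsgOK-suc alice bob   (suc m) (bitA g l r) (hl , hr) =
    MsgOK-mono alice (suc m) l (MsgOK-mono alice m l hl) , MsgOK-mono alice (suc m) r (MsgOK-mono alice m r hr)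
  MsgOK-suc bob   alice (suc m) (bitB g l r) (hl , hr) =
    MsgOK-mono bob (suc m) l (MsgOK-mono bob m l hl) , MsgOK-mono bob (suc m) r (MsgOK-mono bob m r hr)

speaker : Side → Player
speaker sideA = alice
speaker sideB = bob

other : Side → Side
other sideA = sideB
other sideB = sideA

module Water {X Y : Set} {s : ℕ} (P : GHProtocol X Y s) where
  open Messages X Y

  next : ∀ σ → Input (speaker σ) → Fin (suc s) → Maybe (Fin (suc s))
  next sideA x v           = EA P x v
  next sideB y 0F          = nothing
  next sideB y (Fin.suc i) = Maybe.map Fin.suc (EB P y i)

  module _ (x : X) (y : Y) where
    walk-suc : ∀ n σ v → walk P x y (suc n) σ v
                       ≡ maybe′ (λ w → suc (walk P x y n (other σ) w)) 0 (next σ (input (speaker σ) x y) v)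
    walk-suc n sideA v with EA P x v
    ... | nothing = refl
    ... | just w  = refl
    walk-suc n sideB 0F = refl
    walk-suc n sideB (Fin.suc i) with EB P y i
    ... | nothing = refl
    ... | just j  = refl

    walk-⊓ : ∀ {m n} σ v → m ≤ n → walk P x y m σ v ≡ walk P x y n σ v ⊓ m
    walk-⊓ {zero}  {n}     σ v _ = sym (⊓-zeroʳ (walk P x y n σ v))
    walk-⊓ {suc m} {suc n} σ v (s≤s m≤n)
      rewrite walk-suc m σ v | walk-suc n σ v with next σ (input (speaker σ) x y) v
    ... | nothing = refl
    ... | just w  = cong suc (walk-⊓ (other σ) w m≤n)

    walk-≤ : ∀ n σ v → walk P x y n σ v ≤ n
    walk-≤ n σ v = subst (_≤ n) (sym (walk-⊓ {n} σ v ≤-refl)) (m⊓n≤n (walk P x y n σ v) n)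

    walk-fuel : ∀ {m n} σ v → walk P x y n σ v ≤ m → m ≤ n → walk P x y m σ v ≡ walk P x y n σ v
    walk-fuel σ v enough m≤n = trans (walk-⊓ σ v m≤n) (m≤n⇒m⊓n≡m enough)

module Simulation {X Y : Set} {s : ℕ} (P : GHProtocol X Y s) {B : ℕ} (room : suc s < 2 ^ B) where
  open Messages X Y
  open Water P
  open Binary.Code {B = B} room

  -- The last argument counts the edges of the water path announced so far.
  mutual
    simulate : ℕ → Side → Fin (suc s) → ℕ → Proto X Y
    simulate zero    σ v e = leaf (parity e)
    simulate (suc F) σ v e = send (speaker σ) B (λ i → encode (next σ i v)) (continue F σ e ∘ decode)

    continue : ℕ → Side → ℕ → Maybe (Fin (suc s)) → Proto X Y
    continue F σ e nothing  = leaf (parity e)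
    continue F σ e (just w) = simulate F (other σ) w (suc e)

  mutual
    run-simulate : ∀ F σ v e x y → run (simulate F σ v e) x y ≡ parity (e + walk P x y F σ v)
    run-simulate zero    σ v e x y = cong parity (sym (+-identityʳ e))
    run-simulate (suc F) σ v e x y = begin
      run (simulate (suc F) σ v e) x y
        ≡⟨ run-send (speaker σ) B _ _ x y ⟩
      run (continue F σ e (decode (encode o))) x y
        ≡⟨ cong (λ o′ → run (continue F σ e o′) x y) (decode-encode o) ⟩
      run (continue F σ e o) x y
        ≡⟨ run-continue F σ e o x y ⟩
      parity (e + maybe′ (λ w → suc (walk P x y F (other σ) w)) 0 o)
        ≡⟨ cong (parity ∘ (e +_)) (walk-suc x y F σ v) ⟨
      parity (e + walk P x y (suc F) σ v)
        ∎
      where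
      open ≡-Reasoning
      o = next σ (input (speaker σ) x y) v

    run-continue : ∀ F σ e o x y →
                   run (continue F σ e o) x y ≡ parity (e + maybe′ (λ w → suc (walk P x y F (other σ) w)) 0 o)
    run-continue F σ e nothing  x y = cong parity (sym (+-identityʳ e))
    run-continue F σ e (just w) x y =
      trans (run-simulate F (other σ) w (suc e) x y) (cong parity (sym (+-suc e _)))

  mutual
    depth-simulate : ∀ F σ v e → depth (simulate F σ v e) ≤ F * B
    depth-simulate zero    σ v e = z≤n
    depth-simulate (suc F) σ v e = depth-send (speaker σ) B _ _ (depth-continue F σ e ∘ decode)

    depth-continue : ∀ F σ e o → depth (continue F σ e o) ≤ F * B
    depth-continue F σ e nothing  = z≤n
    depth-continue F σ e (just w) = depth-simulate F (other σ) w (suc e)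

  mutual
    MsgOK-simulate : ∀ F σ v e {m} → F ≤ suc m → MsgOK (speaker σ) m (simulate F σ v e)
    MsgOK-simulate zero    σ v e h = tt
    MsgOK-simulate (suc F) σ v e h =
      MsgOK-send (speaker σ) B _ _ λ bits → MsgOK-continue F σ e (decode bits) (s≤s⁻¹ h)

    MsgOK-continue : ∀ F σ e o {m} → F ≤ m → MsgOK (speaker σ) m (continue F σ e o)
    MsgOK-continue F       σ e nothing  h               = tt
    MsgOK-continue zero    σ e (just w) h               = tt
    MsgOK-continue (suc F) σ e (just w) {suc m} (s≤s h) =
      MsgOK-suc (speaker σ) (speaker (other σ)) m _ (MsgOK-simulate (suc F) (other σ) w (suc e) (s≤s h))

HasGH⇒HasD : ∀ {X Y : Set} {f : X → Y → Bool} {k s B} → suc s < 2 ^ B → HasGH f k s → HasD f k (k * B)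
HasGH⇒HasD {f = f} {k} {s} {B} room (P , computes , wet) =
  simulate F sideA 0F 0 , MsgOK-simulate F sideA 0F 0 F≤1+[k∸1] , correct , depth≤
  where
  open Simulation P {B} room
  open Water P

  F = k ⊓ suc s

  F≤1+[k∸1] : F ≤ suc (k ∸ 1)
  F≤1+[k∸1] = ≤-trans (m⊓n≤m k (suc s)) (m≤n+m∸n k 1)

  correct : ∀ x y → run (simulate F sideA 0F 0) x y ≡ f x y
  correct x y = begin
    run (simulate F sideA 0F 0) x y ≡⟨ run-simulate F sideA 0F 0 x y ⟩
    parity (walk P x y F sideA 0F)  ≡⟨ cong parity (walk-fuel x y sideA 0F path≤F (m⊓n≤n k (suc s))) ⟩
    parity (pathEdges P x y)        ≡⟨ computes x y ⟩
    f x y                           ∎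
    where
    open ≡-Reasoning
    path≤F = ⊓-glb (wet x y) (walk-≤ x y (suc s) sideA 0F)

  depth≤ : depth (simulate F sideA 0F 0) ≤ k * B
  depth≤ = ≤-trans (depth-simulate F sideA 0F 0) (*-monoˡ-≤ B (m⊓n≤m k (suc s)))

2^-between : ∀ n .{{_ : NonZero n}} → ∃[ B ] n < 2 ^ B × 2 ^ B ≤ 2 * n
2^-between 1 = 1 , ≤-refl , ≤-refl
2^-between (suc (suc n)) with 2^-between (suc n)
... | B , 1+n<2^B , 2^B≤2+2n with suc (suc n) <? 2 ^ B
...   | yes 2+n<2^B = B , 2+n<2^B , ≤-trans 2^B≤2+2n (*-monoʳ-≤ 2 (n≤1+n (suc n)))
...   | no  2+n≮2^B = suc B , subst (suc (suc n) <_) (sym 2^[1+B]≡2[2+n]) (m<m+n (suc (suc n)) z<s)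
                         , ≤-reflexive 2^[1+B]≡2[2+n]
  where
  2^[1+B]≡2[2+n] : 2 ^ suc B ≡ 2 * suc (suc n)
  2^[1+B]≡2[2+n] = cong (2 *_) (≤-antisym (≮⇒≥ 2+n≮2^B) 1+n<2^B)

theorem7 : ∃[ C ] (∀ (n : ℕ) (f : BoolFun n) (k : ℕ) → 1 ≤ k → ∀ (s d : ℕ) → IsGH f k s → IsD f k d → 2 ^ d ≤ (C * suc s) ^ k)
theorem7 = 2 , bound
  where
  bound : ∀ n (f : BoolFun n) k → 1 ≤ k → ∀ s d → IsGH f k s → IsD f k d → 2 ^ d ≤ (2 * suc s) ^ k
  bound n f k _ s d (gh , _) (_ , d-minimal) with 2^-between (suc s)
  ... | B , room , 2^B≤2[1+s] = begin
    2 ^ d           ≤⟨ ^-monoʳ-≤ 2 (d-minimal (k * B) (HasGH⇒HasD room gh)) ⟩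
    2 ^ (k * B)     ≡⟨ cong (2 ^_) (*-comm k B) ⟩
    2 ^ (B * k)     ≡⟨ ^-*-assoc 2 B k ⟨
    (2 ^ B) ^ k     ≤⟨ ^-monoˡ-≤ k 2^B≤2[1+s] ⟩
    (2 * suc s) ^ k ∎
    where open ≤-Reasoning
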